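{- Let $q$ be a prime power and let $z$ and $t$ be positive integers with $z\geq 3$ and $t\leq \sqrt{q(z-1)/z}$. Let $\mathcal{U}\subset \mathrm{AG}(2,q)$ be a set of $q-t$ affine points and let $E\subseteq F$ be two sets of directions (points of the line at infinity $\ell_\infty$ of $\mathrm{PG}(2,q)=\mathrm{AG}(2,q)\cup\ell_\infty$) satisfying: (1) through each point of $\mathcal{U}$ there are at least $t$ tangents to $\mathcal{U}$ with direction in $F$; (2) there exists a set $\mathcal{P}$ of $t$ affine points with $\mathcal{U}\cap\mathcal{P}=\emptyset$ such that each tangent to $\mathcal{U}$ with direction not in $E$ intersects $\mathcal{U}\cup\mathcal{P}$ in $0 \pmod z$ points. Then $|E|\geq t$.
   Context: A tangent to a point set $\mathcal{U}$ is a line meeting $\mathcal{U}$ in exactly one point. The direction of an affine line is its point at infinity. -}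

module Defs where

open import Level using (0ℓ)
open import Data.Nat using (ℕ; suc)
open import Data.Fin using (Fin)
open import Data.Fin.Properties renaming (_≟_ to _≟F_)
open import Data.Maybe using (Maybe; just; nothing)
open import Data.Product using (_×_; _,_; Σ; ∃)
open import Data.List using (List; filter; length)
open import Relation.Binary.PropositionalEquality using (_≡_; _≢_)
open import Relation.Nullary using (Dec; yes; no)
import Algebra.Structures as AS

-- A finite field with exactly q elements, with carrier Fin q and
-- propositional equality.  (Its order q is then necessarily a prime
-- power, and every prime power q arises; it is GF(q) up to isomorphism.)
record FiniteField (q : ℕ) : Set where
  field
    _+_ _*_ : Fin q → Fin q → Fin q
    -_      : Fin q → Fin q
    0# 1#   : Fin q
    isCommutativeRing : AS.IsCommutativeRing {A = Fin q} _≡_ _+_ _*_ -_ 0# 1#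
    0≢1     : 0# ≢ 1#
    inverse : ∀ x → x ≢ 0# → Σ (Fin q) λ y → x * y ≡ 1#

module Plane {q : ℕ} (𝔽 : FiniteField q) where
  open FiniteField 𝔽

  Point : Set
  Point = Fin q × Fin q

  -- points of the line at infinity ℓ∞ (directions):
  -- just m = direction of slope m, nothing = vertical direction
  Direction : Set
  Direction = Maybe (Fin q)

  -- affine lines: (just m , b) is y = m x + b ; (nothing , c) is x = c.
  -- This parametrisation is a bijection onto the affine lines of AG(2,q).
  Line : Set
  Line = Direction × Fin q

  dir : Line → Direction
  dir (d , _) = d

  _∈L_ : Point → Line → Set
  (x , y) ∈L (just m , b) = y ≡ (m * x) + b
  (x , y) ∈L (nothing , c) = x ≡ c

  _∈L?_ : (p : Point) → (ℓ : Line) → Dec (p ∈L ℓ)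
  (x , y) ∈L? (just m , b) = y ≟F ((m * x) + b)
  (x , y) ∈L? (nothing , c) = x ≟F c

  -- number of points of a (duplicate-free) point list on a line
  count : Line → List Point → ℕ
  count ℓ S = length (filter (λ p → p ∈L? ℓ) S)

  Tangent : List Point → Line → Set
  Tangent S ℓ = count ℓ S ≡ 1

module Submission where

-- Suppose |E| < t.
--   * Distinct lines through one point have distinct directions, so among the
--     at least t tangents to U through a point u ∈ U given by hypothesis (1),
--     one, say ℓᵤ, has its direction outside E.
--   * By hypothesis (2), z divides |ℓᵤ ∩ U| + |ℓᵤ ∩ P| = 1 + |ℓᵤ ∩ P|, and
--     z ≥ 3 forces ℓᵤ to contain two distinct points of P.
--   * Two distinct points lie on at most one line, and a tangent to U meets U
--     only once, so u ↦ (ordered pair of distinct points of P on ℓᵤ) is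
--     injective: q − t = |U| ≤ t(t − 1), i.e. q ≤ t².
--   * Then t²z ≤ q(z − 1) ≤ t²(z − 1) < t²z, which is absurd.

open import Defs
open import Data.Nat using (ℕ; _+_; _*_; _∸_; _≤_)
open import Data.Nat.Divisibility using (_∣_)
open import Data.Product using (_×_; Σ)
open import Data.List using (List; length)
open import Data.List.Membership.Propositional using (_∈_; _∉_)
open import Data.List.Relation.Unary.All using (All)
open import Data.List.Relation.Unary.Unique.Propositional using (Unique)
open import Relation.Binary.PropositionalEquality using (_≡_)

open import Data.Nat using (suc; zero; s≤s; z≤n; _<_; _≤?_)
import Data.Nat.Properties as NP
open import Data.Nat.Divisibility using (∣⇒≤)
open import Data.Fin as Fin using (Fin; punchOut; combine)
import Data.Fin.Properties as FP
open import Data.Product using (_,_; proj₁; proj₂)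
open import Data.Maybe using (just; nothing)
import Data.Maybe.Properties as MP
open import Data.List using (_∷_; []; filter; lookup)
open import Data.List.Relation.Unary.Any as Any using (here; there; any?)
import Data.List.Relation.Unary.All as All
open import Data.List.Relation.Unary.AllPairs using (_∷_)
import Data.List.Relation.Unary.Unique.Propositional.Properties as UniqueP
open import Data.List.Membership.Propositional using (find; lose)
open import Data.List.Membership.Propositional.Properties using (∈-lookup; ∈-filter⁺; ∈-filter⁻)
import Data.List.Membership.Setoid.Properties as Membershipₛ
import Data.List.Membership.DecPropositional as DecMembership
open import Relation.Binary.PropositionalEquality using (refl; sym; trans; cong; cong₂; subst; subst₂; _≢_; setoid; module ≡-Reasoning)
open import Relation.Nullary using (¬_; yes; no; ¬?)
open import Relation.Nullary.Decidable using (decidable-stable)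
open import Data.Empty using (⊥-elim)
open import Algebra.Bundles using (CommutativeRing)
import Algebra.Properties.Group as GroupProperties

index-injective : ∀ {A : Set} {xs : List A} {x y : A} (x∈ : x ∈ xs) (y∈ : y ∈ xs) →
  Any.index x∈ ≡ Any.index y∈ → x ≡ y
index-injective {A} = Membershipₛ.index-injective (setoid A)

unique-lookup-injective : ∀ {A : Set} {xs : List A} → Unique xs →
  ∀ {i j} → lookup xs i ≡ lookup xs j → i ≡ j
unique-lookup-injective {xs = _ ∷ _} (_ ∷ _) {Fin.zero} {Fin.zero} _ = refl
unique-lookup-injective {xs = _ ∷ _} (x∉ ∷ _) {Fin.zero} {Fin.suc j} e = ⊥-elim (All.lookup x∉ (∈-lookup j) e)
unique-lookup-injective {xs = _ ∷ _} (x∉ ∷ _) {Fin.suc i} {Fin.zero} e = ⊥-elim (All.lookup x∉ (∈-lookup i) (sym e))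
unique-lookup-injective {xs = _ ∷ _} (_ ∷ u) {Fin.suc i} {Fin.suc j} e = cong Fin.suc (unique-lookup-injective u e)

unique-length≤ : ∀ {A : Set} {n : ℕ} {xs : List A} → Unique xs →
  (f : ∀ {x} → x ∈ xs → Fin n) →
  (∀ {x y} (x∈ : x ∈ xs) (y∈ : y ∈ xs) → f x∈ ≡ f y∈ → x ≡ y) →
  length xs ≤ n
unique-length≤ {xs = xs} u f f-inj =
  FP.injective⇒≤ {f = f-at} (λ e → unique-lookup-injective u (f-inj (∈-lookup _) (∈-lookup _) e))
  where
  f-at : Fin (length xs) → Fin _
  f-at i = f (∈-lookup {xs = xs} i)

injection-length≤ : ∀ {A B : Set} {xs : List A} {ys : List B} (g : A → B) → Unique xs →
  (∀ {x} → x ∈ xs → g x ∈ ys) →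
  (∀ {x y} → x ∈ xs → y ∈ xs → g x ≡ g y → x ≡ y) →
  length xs ≤ length ys
injection-length≤ g u into inj =
  unique-length≤ u (λ x∈ → Any.index (into x∈))
    (λ x∈ y∈ e → inj x∈ y∈ (index-injective (into x∈) (into y∈) e))

length≡1⇒members-equal : ∀ {A : Set} {xs : List A} → length xs ≡ 1 →
  ∀ {x y} → x ∈ xs → y ∈ xs → x ≡ y
length≡1⇒members-equal {xs = _ ∷ []} _ (here x≡a) (here y≡a) = trans x≡a (sym y≡a)

record TwoDistinct {A : Set} (xs : List A) : Set where
  field
    first second : A
    distinct : first ≢ second
    first∈ : first ∈ xs
    second∈ : second ∈ xs

two-distinct : ∀ {A : Set} {xs : List A} → Unique xs → 2 ≤ length xs → TwoDistinct xs
two-distinct {xs = x ∷ y ∷ _} ((x≢y All.∷ _) ∷ _) _ = record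
  { first = x ; second = y ; distinct = x≢y ; first∈ = here refl ; second∈ = there (here refl) }
two-distinct {xs = _ ∷ []} _ (s≤s ())

distinct-pair-code : ∀ {n} (i j : Fin n) → i ≢ j → Fin (n * (n ∸ 1))
distinct-pair-code {suc _} i _ i≢j = combine i (punchOut i≢j)

distinct-pair-code-injective : ∀ {n} {i j i′ j′ : Fin n} (i≢j : i ≢ j) (i′≢j′ : i′ ≢ j′) →
  distinct-pair-code i j i≢j ≡ distinct-pair-code i′ j′ i′≢j′ → i ≡ i′ × j ≡ j′
distinct-pair-code-injective {suc _} {i} {j} {i′} {j′} i≢j i′≢j′ e
  with FP.combine-injective i (punchOut i≢j) i′ (punchOut i′≢j′) e
... | refl , same-rest = refl , FP.punchOut-injective i≢j i′≢j′ same-rest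

divides-suc⇒2≤ : ∀ {z} c → 3 ≤ z → z ∣ suc c → 2 ≤ c
divides-suc⇒2≤ zero 3≤z z∣1 = ⊥-elim (NP.<⇒≱ (NP.<-≤-trans (s≤s (s≤s z≤n)) 3≤z) (∣⇒≤ z∣1))
divides-suc⇒2≤ (suc zero) 3≤z z∣2 = ⊥-elim (NP.<⇒≱ 3≤z (∣⇒≤ z∣2))
divides-suc⇒2≤ (suc (suc c)) _ _ = s≤s (s≤s z≤n)

-- Under t²z ≤ q(z − 1), the bound q − t ≤ t(t − 1) is impossible: it gives
-- q ≤ t², hence t²z ≤ t²(z − 1).
no-room-for-pairs : ∀ q t z → 1 ≤ t → 1 ≤ z → t * t * z ≤ q * (z ∸ 1) →
  ¬ (q ∸ t ≤ t * (t ∸ 1))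
no-room-for-pairs q (suc k) (suc c) _ _ t²z≤q[z∸1] q∸t≤ =
  NP.<⇒≱ t²c<t²z (NP.≤-trans t²z≤q[z∸1] (NP.*-monoˡ-≤ c q≤t²))
  where
  open NP.≤-Reasoning
  t² = suc k * suc k
  q≤t² : q ≤ t²
  q≤t² = begin
    q                    ≤⟨ NP.m≤n+m∸n q (suc k) ⟩
    suc k + (q ∸ suc k)  ≤⟨ NP.+-monoʳ-≤ (suc k) q∸t≤ ⟩
    suc k + suc k * k    ≡⟨ NP.*-suc (suc k) k ⟨
    t² ∎
  t²c<t²z : t² * c < t² * suc c
  t²c<t²z = NP.*-monoʳ-< t² (NP.n<1+n c)

module AffinePlane {q : ℕ} (𝔽 : FiniteField q) where
  open FiniteField 𝔽 renaming (_+_ to infixl 6 _+F_; _*_ to infixl 7 _*F_; -_ to infix 8 -F_)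
  open Plane 𝔽

  ring : CommutativeRing _ _
  ring = record { isCommutativeRing = isCommutativeRing }
  open CommutativeRing ring using (+-group; +-assoc; *-assoc; *-identityʳ; distribˡ; -‿inverseˡ; +-identityʳ)
  open GroupProperties +-group using (∙-cancelˡ; ∙-cancelʳ; x∙y⁻¹≈ε⇒x≈y)

  cancel-invertible : ∀ a b d e → a *F d ≡ b *F d → d *F e ≡ 1# → a ≡ b
  cancel-invertible a b d e ad≡bd de≡1 = begin
    a                ≡⟨ *-identityʳ a ⟨
    a *F 1#          ≡⟨ cong (a *F_) de≡1 ⟨
    a *F (d *F e)    ≡⟨ *-assoc a d e ⟨
    (a *F d) *F e    ≡⟨ cong (_*F e) ad≡bd ⟩
    (b *F d) *F e    ≡⟨ *-assoc b d e ⟩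
    b *F (d *F e)    ≡⟨ cong (b *F_) de≡1 ⟩
    b *F 1#          ≡⟨ *-identityʳ b ⟩
    b ∎
    where open ≡-Reasoning

  ordinate-shift : ∀ m x₁ x₂ b → m *F x₁ +F b ≡ m *F (x₁ +F -F x₂) +F (m *F x₂ +F b)
  ordinate-shift m x₁ x₂ b = begin
    m *F x₁ +F b                             ≡⟨ cong (λ w → m *F w +F b) x₁-x₂+x₂ ⟨
    m *F ((x₁ +F -F x₂) +F x₂) +F b          ≡⟨ cong (_+F b) (distribˡ m (x₁ +F -F x₂) x₂) ⟩
    (m *F (x₁ +F -F x₂) +F m *F x₂) +F b     ≡⟨ +-assoc _ _ _ ⟩
    m *F (x₁ +F -F x₂) +F (m *F x₂ +F b) ∎
    where
    open ≡-Reasoning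
    x₁-x₂+x₂ : (x₁ +F -F x₂) +F x₂ ≡ x₁
    x₁-x₂+x₂ = trans (+-assoc x₁ (-F x₂) x₂) (trans (cong (x₁ +F_) (-‿inverseˡ x₂)) (+-identityʳ x₁))

  slope-line-graph : ∀ {x₁ y₁ x₂ y₂ m b} → x₁ ≡ x₂ →
    (x₁ , y₁) ∈L (just m , b) → (x₂ , y₂) ∈L (just m , b) → (x₁ , y₁) ≡ (x₂ , y₂)
  slope-line-graph refl on₁ on₂ = cong (_ ,_) (trans on₁ (sym on₂))

  two-points-one-line : ∀ {p₁ p₂} → p₁ ≢ p₂ → ∀ {ℓ ℓ′} →
    p₁ ∈L ℓ → p₂ ∈L ℓ → p₁ ∈L ℓ′ → p₂ ∈L ℓ′ → ℓ ≡ ℓ′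
  two-points-one-line {x₁ , y₁} {x₂ , y₂} p₁≢p₂ {nothing , c} {nothing , c′} a₁ _ b₁ _ =
    cong (nothing ,_) (trans (sym a₁) b₁)
  two-points-one-line {x₁ , y₁} {x₂ , y₂} p₁≢p₂ {nothing , c} {just m , b} a₁ a₂ b₁ b₂ =
    ⊥-elim (p₁≢p₂ (slope-line-graph (trans a₁ (sym a₂)) b₁ b₂))
  two-points-one-line {x₁ , y₁} {x₂ , y₂} p₁≢p₂ {just m , b} {nothing , c} a₁ a₂ b₁ b₂ =
    ⊥-elim (p₁≢p₂ (slope-line-graph (trans b₁ (sym b₂)) a₁ a₂))
  two-points-one-line {x₁ , y₁} {x₂ , y₂} p₁≢p₂ {just m , b} {just m′ , b′} a₁ a₂ b₁ b₂ =
    cong₂ (λ s c → just s , c) m≡m′ b≡b′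
    where
    δ = x₁ +F -F x₂
    at₁ : m *F x₁ +F b ≡ m′ *F x₁ +F b′
    at₁ = trans (sym a₁) b₁
    at₂ : m *F x₂ +F b ≡ m′ *F x₂ +F b′
    at₂ = trans (sym a₂) b₂
    mδ≡m′δ : m *F δ ≡ m′ *F δ
    mδ≡m′δ = ∙-cancelʳ (m *F x₂ +F b) (m *F δ) (m′ *F δ)
      (trans (sym (ordinate-shift m x₁ x₂ b))
      (trans at₁ (trans (ordinate-shift m′ x₁ x₂ b′) (cong (m′ *F δ +F_) (sym at₂)))))
    δ≢0 : δ ≢ 0#
    δ≢0 δ≡0 = p₁≢p₂ (slope-line-graph (x∙y⁻¹≈ε⇒x≈y x₁ x₂ δ≡0) a₁ a₂)
    m≡m′ : m ≡ m′
    m≡m′ with inverse δ δ≢0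
    ... | δ⁻¹ , δδ⁻¹≡1 = cancel-invertible m m′ δ δ⁻¹ mδ≡m′δ δδ⁻¹≡1
    b≡b′ : b ≡ b′
    b≡b′ = ∙-cancelˡ (m *F x₁) b b′ (trans at₁ (cong (λ s → s *F x₁ +F b′) (sym m≡m′)))

  point-direction-line : ∀ {u ℓ ℓ′} → u ∈L ℓ → u ∈L ℓ′ → dir ℓ ≡ dir ℓ′ → ℓ ≡ ℓ′
  point-direction-line {x , y} {nothing , c} {nothing , c′} u∈ℓ u∈ℓ′ refl =
    cong (nothing ,_) (trans (sym u∈ℓ) u∈ℓ′)
  point-direction-line {x , y} {just m , b} {just m , b′} u∈ℓ u∈ℓ′ refl =
    cong (just m ,_) (∙-cancelˡ (m *F x) b b′ (trans (sym u∈ℓ) u∈ℓ′))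

  meet : Line → List Point → List Point
  meet ℓ S = filter (λ p → p ∈L? ℓ) S

  meet-member : ∀ ℓ S {p} → p ∈ meet ℓ S → p ∈ S × p ∈L ℓ
  meet-member ℓ S = ∈-filter⁻ (λ p → p ∈L? ℓ) {xs = S}

  tangent-single-point : ∀ {S ℓ} → Tangent S ℓ → ∀ {u u′} →
    u ∈ S → u ∈L ℓ → u′ ∈ S → u′ ∈L ℓ → u ≡ u′
  tangent-single-point {S} {ℓ} tangent u∈ u∈ℓ u′∈ u′∈ℓ =
    length≡1⇒members-equal tangent (∈-filter⁺ (λ p → p ∈L? ℓ) u∈ u∈ℓ) (∈-filter⁺ (λ p → p ∈L? ℓ) u′∈ u′∈ℓ)

  open DecMembership (MP.≡-dec (FP._≟_ {q})) using (_∈?_)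

  -- Lines through a common point are determined by their directions, so more
  -- such lines than directions in E include one whose direction is not in E.
  direction-outside : ∀ {u} (Ls : List Line) (E : List Direction) → Unique Ls →
    All (u ∈L_) Ls → length E < length Ls → Σ Line λ ℓ → ℓ ∈ Ls × dir ℓ ∉ E
  direction-outside Ls E unique through E<Ls with any? (λ ℓ → ¬? (dir ℓ ∈? E)) Ls
  ... | yes found = find found
  ... | no none = ⊥-elim (NP.<⇒≱ E<Ls Ls≤E)
    where
    in-E : ∀ {ℓ} → ℓ ∈ Ls → dir ℓ ∈ E
    in-E ℓ∈ = decidable-stable (_ ∈? E) (λ ∉E → none (lose ℓ∈ ∉E))
    Ls≤E : length Ls ≤ length E
    Ls≤E = injection-length≤ dir unique in-E
      (λ ℓ∈ ℓ′∈ → point-direction-line (All.lookup through ℓ∈) (All.lookup through ℓ′∈))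

  module DoubleCounting (z : ℕ) (3≤z : 3 ≤ z) (U : List Point) (E : List Direction)
    (P : List Point) (unique-P : Unique P)
    (divisible : ∀ ℓ → Tangent U ℓ → dir ℓ ∉ E → z ∣ (count ℓ U + count ℓ P))
    where

    record SecantTangent (u : Point) : Set where
      field
        line : Line
        through : u ∈L line
        tangent : Tangent U line
        secant : TwoDistinct (meet line P)

    secant-tangent : ∀ {u ℓ} → u ∈L ℓ → Tangent U ℓ → dir ℓ ∉ E → SecantTangent u
    secant-tangent {ℓ = ℓ} u∈ℓ tangent ∉E = record
      { line = ℓ ; through = u∈ℓ ; tangent = tangent
      ; secant = two-distinct (UniqueP.filter⁺ (λ p → p ∈L? ℓ) unique-P) two-on-ℓ }
      where
      z∣1+count : z ∣ suc (count ℓ P)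
      z∣1+count = subst (λ n → z ∣ (n + count ℓ P)) tangent (divisible ℓ tangent ∉E)
      two-on-ℓ : 2 ≤ count ℓ P
      two-on-ℓ = divides-suc⇒2≤ (count ℓ P) 3≤z z∣1+count

    secant-tangent-everywhere : ∀ {t} {F : List Direction} → length E < t →
      (∀ u → u ∈ U → Σ (List Line) λ Ls → Unique Ls × t ≤ length Ls ×
        All (λ ℓ → u ∈L ℓ × Tangent U ℓ × dir ℓ ∈ F) Ls) →
      ∀ {u} → u ∈ U → SecantTangent u
    secant-tangent-everywhere E<t tangents {u} u∈ with tangents u u∈
    ... | Ls , unique-Ls , t≤Ls , props with direction-outside Ls E unique-Ls (All.map proj₁ props) (NP.<-≤-trans E<t t≤Ls)
    ...   | ℓ , ℓ∈ , ∉E = secant-tangent (proj₁ ℓ-props) (proj₁ (proj₂ ℓ-props)) ∉E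
      where ℓ-props = All.lookup props ℓ∈

    first∈P : ∀ {u} (s : SecantTangent u) → TwoDistinct.first (SecantTangent.secant s) ∈ P
    first∈P s = proj₁ (meet-member _ P (TwoDistinct.first∈ (SecantTangent.secant s)))

    second∈P : ∀ {u} (s : SecantTangent u) → TwoDistinct.second (SecantTangent.secant s) ∈ P
    second∈P s = proj₁ (meet-member _ P (TwoDistinct.second∈ (SecantTangent.secant s)))

    code : ∀ {u} → SecantTangent u → Fin (length P * (length P ∸ 1))
    code s = distinct-pair-code (Any.index (first∈P s)) (Any.index (second∈P s))
      (λ e → TwoDistinct.distinct (SecantTangent.secant s) (index-injective (first∈P s) (second∈P s) e))

    -- The code determines the line (two points span it), and the line,
    -- being tangent to U, determines the point of U.
    code-injective : ∀ {u u′} → u ∈ U → u′ ∈ U → (s : SecantTangent u) (s′ : SecantTangent u′) →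
      code s ≡ code s′ → u ≡ u′
    code-injective u∈ u′∈ s s′ e
      with distinct-pair-code-injective {length P} {Any.index (first∈P s)} {Any.index (second∈P s)}
             {Any.index (first∈P s′)} {Any.index (second∈P s′)} _ _ e
    ... | same-first , same-second =
      tangent-single-point S.tangent u∈ S.through u′∈ (subst (_ ∈L_) (sym same-line) S′.through)
      where
      module S = SecantTangent s
      module S′ = SecantTangent s′
      module T = TwoDistinct S.secant
      module T′ = TwoDistinct S′.secant
      first≡ : T.first ≡ T′.first
      first≡ = index-injective (first∈P s) (first∈P s′) same-first
      second≡ : T.second ≡ T′.second
      second≡ = index-injective (second∈P s) (second∈P s′) same-second
      same-line : S.line ≡ S′.line
      same-line = two-points-one-line T.distinct
        (proj₂ (meet-member S.line P T.first∈)) (proj₂ (meet-member S.line P T.second∈))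
        (subst (_∈L S′.line) (sym first≡) (proj₂ (meet-member S′.line P T′.first∈)))
        (subst (_∈L S′.line) (sym second≡) (proj₂ (meet-member S′.line P T′.second∈)))

    U-bound : Unique U → (∀ {u} → u ∈ U → SecantTangent u) → length U ≤ length P * (length P ∸ 1)
    U-bound unique-U choose = unique-length≤ unique-U (λ u∈ → code (choose u∈))
      (λ u∈ u′∈ → code-injective u∈ u′∈ (choose u∈) (choose u′∈))

lemma2p12 : (q : ℕ) (𝔽 : FiniteField q) → let open Plane 𝔽 in
    (z t : ℕ) → 3 ≤ z → 1 ≤ t → t * t * z ≤ q * (z ∸ 1) →
    (U : List Point) → Unique U → length U ≡ q ∸ t →
    (E F : List Direction) → Unique E → (∀ d → d ∈ E → d ∈ F) →
    (∀ u → u ∈ U → Σ (List Line) λ Ls → Unique Ls × t ≤ length Ls ×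
    All (λ ℓ → u ∈L ℓ × Tangent U ℓ × dir ℓ ∈ F) Ls) →
    (Σ (List Point) λ P → Unique P × length P ≡ t × (∀ p → p ∈ P → p ∉ U) ×
    (∀ ℓ → Tangent U ℓ → dir ℓ ∉ E → z ∣ (count ℓ U + count ℓ P))) →
    t ≤ length E
lemma2p12 q 𝔽 z t 3≤z 1≤t t²z≤q[z∸1] U unique-U |U|≡q∸t E F _ _ tangents
          (P , unique-P , |P|≡t , _ , divisible) with t ≤? length E
... | yes t≤E = t≤E
... | no t≰E = ⊥-elim (no-room-for-pairs q t z 1≤t (NP.≤-trans (s≤s z≤n) 3≤z) t²z≤q[z∸1] q∸t≤t[t∸1])
  where
  open AffinePlane 𝔽
  open DoubleCounting z 3≤z U E P unique-P divisible
  q∸t≤t[t∸1] : q ∸ t ≤ t * (t ∸ 1)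
  q∸t≤t[t∸1] = subst₂ _≤_ |U|≡q∸t (cong (λ n → n * (n ∸ 1)) |P|≡t)
    (U-bound unique-U (secant-tangent-everywhere (NP.≰⇒> t≰E) tangents))
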